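{- Let $a, b, c$ be nonzero integers with $\gcd(a,b,c)=1$ and let $m, n$ be positive integers. If $X, Y \in M_2(\mathbb{Z})$ satisfy $aX^m + bY^n = cI$ and $XY \neq YX$, then $X^m$ and $Y^n$ are scalar matrices.
   Context: $M_2(\mathbb{Z})$ denotes the ring of $2\times 2$ matrices with integer entries, and $I$ is the $2\times 2$ identity matrix. A scalar matrix is a matrix of the form $\lambda I$. -}

module Defs where

open import Data.Nat using (ℕ; zero; suc)
open import Data.Integer using (ℤ; 0ℤ; 1ℤ) renaming (_+_ to _+ℤ_; _*_ to _*ℤ_)
open import Relation.Binary.PropositionalEquality using (_≡_)
open import Data.Product using (∃-syntax)

record M₂ : Set where
  constructor mat
  field
    e11 e12 e21 e22 : ℤ
open M₂ public

infixl 6 _+M_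
infixl 7 _*M_

_+M_ : M₂ → M₂ → M₂
A +M B = mat (e11 A +ℤ e11 B) (e12 A +ℤ e12 B) (e21 A +ℤ e21 B) (e22 A +ℤ e22 B)

_*M_ : M₂ → M₂ → M₂
A *M B = mat (e11 A *ℤ e11 B +ℤ e12 A *ℤ e21 B) (e11 A *ℤ e12 B +ℤ e12 A *ℤ e22 B)
             (e21 A *ℤ e11 B +ℤ e22 A *ℤ e21 B) (e21 A *ℤ e12 B +ℤ e22 A *ℤ e22 B)

_·M_ : ℤ → M₂ → M₂
k ·M A = mat (k *ℤ e11 A) (k *ℤ e12 A) (k *ℤ e21 A) (k *ℤ e22 A)

I : M₂
I = mat 1ℤ 0ℤ 0ℤ 1ℤ

_^M_ : M₂ → ℕ → M₂
A ^M zero = I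
A ^M suc n = A *M (A ^M n)

IsScalar : M₂ → Set
IsScalar A = ∃[ λ' ] A ≡ λ' ·M I

{-# OPTIONS --safe #-}
-- Write δ A = (p − s, q, r) for A = (p q ; r s), the image of A modulo scalar matrices; δ A = 0 exactly
-- when A is scalar, and the entries of XY − YX are the 2 × 2 minors of (δ X, δ Y), so X and Y
-- commute iff δ X ∥ δ Y.  Applying δ to a Xᵐ + b Yⁿ = c I gives a δ(Xᵐ) = − b δ(Yⁿ).  If Xᵐ were
-- not scalar, then δ X ∥ δ(Xᵐ) ∥ δ(Yⁿ) ∥ δ Y with δ(Xᵐ) ≠ 0, so δ X ∥ δ Y and X, Y would commute.
-- Hence Xᵐ is scalar, and then b δ(Yⁿ) = 0 with b ≠ 0 makes Yⁿ scalar too.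
module Submission where

open import Defs
open import Data.Nat using (ℕ; NonZero; zero; suc)
open import Data.Fin using (Fin)
open import Data.Fin.Patterns using (0F; 1F; 2F)
open import Data.Fin.Properties using (all?; ¬∀⟶∃¬)
open import Data.Vec.Functional using (Vector)
open import Data.List using ([]; _∷_)
open import Data.Integer using (ℤ; 0ℤ; 1ℤ; _+_; _*_; _-_; _≟_)
open import Data.Integer.Base using (≢-nonZero)
open import Data.Integer.Properties
  using (*-cancelˡ-≡; i-j≡0⇒i≡j; i≡j⇒i-j≡0; *-identityʳ; *-zeroʳ; i*j≡0⇒i≡0∨j≡0)
open import Data.Integer.Tactic.RingSolver using (solve-∀; solve)
open import Data.Integer.GCD using (gcd)
open import Data.Product using (_×_; _,_)
open import Data.Sum using ([_,_]′)
open import Data.Empty using (⊥-elim)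
open import Function using (id)
open import Relation.Nullary using (Dec)
open import Relation.Nullary.Decidable using (decidable-stable)
open import Relation.Binary.PropositionalEquality

a*x+b*y≡0⇒y≡0 : ∀ a {b x y} → b ≢ 0ℤ → x ≡ 0ℤ → a * x + b * y ≡ 0ℤ → y ≡ 0ℤ
a*x+b*y≡0⇒y≡0 a {b} {y = y} b≢0 refl sum≡0 =
  [ (λ b≡0 → ⊥-elim (b≢0 b≡0)) , id ]′ (i*j≡0⇒i≡0∨j≡0 b b*y≡0)
  where
  zero-summand : ∀ k z → z ≡ k * 0ℤ + z
  zero-summand = solve-∀
  b*y≡0 : b * y ≡ 0ℤ
  b*y≡0 = trans (zero-summand a (b * y)) sum≡0

≡-from-differences : ∀ {x y x′ y′} → x - y ≡ x′ - y′ → x ≡ y → x′ ≡ y′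
≡-from-differences {x′ = x′} {y′} eq x≡y = i-j≡0⇒i≡j x′ y′ (trans (sym eq) (i≡j⇒i-j≡0 x≡y))

infix 4 _∥_

record _∥_ {n} (u v : Vector ℤ n) : Set where
  constructor minors-vanish
  field minor : ∀ i j → u i * v j ≡ u j * v i
open _∥_

∥₃ : {u v : Vector ℤ 3} →
     u 0F * v 1F ≡ u 1F * v 0F → u 0F * v 2F ≡ u 2F * v 0F → u 1F * v 2F ≡ u 2F * v 1F → u ∥ v
∥₃ m₀₁ m₀₂ m₁₂ = minors-vanish λ where
  0F 0F → refl
  0F 1F → m₀₁
  0F 2F → m₀₂
  1F 0F → sym m₀₁
  1F 1F → refl
  1F 2F → m₁₂
  2F 0F → sym m₀₂
  2F 1F → sym m₁₂
  2F 2F → refl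

∥-euclidean : ∀ {n} {u v w : Vector ℤ n} (k : Fin n) → u k ≢ 0ℤ → u ∥ v → u ∥ w → v ∥ w
∥-euclidean {u = u} {v} {w} k uₖ≢0 u∥v u∥w = minors-vanish λ i j → cancel (cancel (begin
    u k * (u k * (v i * w j)) ≡⟨ regroup (u k) (v i) (w j) ⟩
    (u k * v i) * (u k * w j) ≡⟨ cong₂ _*_ (minor u∥v k i) (minor u∥w k j) ⟩
    (u i * v k) * (u j * w k) ≡⟨ exchange (u i) (v k) (u j) (w k) ⟩
    (u j * v k) * (u i * w k) ≡⟨ cong₂ _*_ (minor u∥v j k) (minor u∥w i k) ⟩
    (u k * v j) * (u k * w i) ≡⟨ sym (regroup (u k) (v j) (w i)) ⟩
    u k * (u k * (v j * w i)) ∎))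
  where
  open ≡-Reasoning
  cancel : ∀ {x y} → u k * x ≡ u k * y → x ≡ y
  cancel = *-cancelˡ-≡ (u k) _ _ {{≢-nonZero uₖ≢0}}
  regroup : ∀ k x y → k * (k * (x * y)) ≡ (k * x) * (k * y)
  regroup = solve-∀
  exchange : ∀ a x b y → (a * x) * (b * y) ≡ (b * x) * (a * y)
  exchange = solve-∀

proportional-∥ : ∀ {n} a b {u v w : Vector ℤ n} →
                 a ≢ 0ℤ → (∀ i → a * u i + b * v i ≡ 0ℤ) → v ∥ w → u ∥ w
proportional-∥ a b {u} {v} {w} a≢0 au+bv≡0 v∥w = minors-vanish λ i j →
  *-cancelˡ-≡ a _ _ {{≢-nonZero a≢0}} (begin
    a * (u i * w j)                             ≡⟨ expand (u i) (v i) (w j) ⟩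
    (a * u i + b * v i) * w j - b * (v i * w j)
      ≡⟨ cong₂ (λ s t → s * w j - b * t) (au+bv≡0 i) (minor v∥w i j) ⟩
    0ℤ * w j - b * (v j * w i)                  ≡⟨ zero-factor (w j) (w i) (b * (v j * w i)) ⟩
    0ℤ * w i - b * (v j * w i)
      ≡⟨ cong (λ s → s * w i - b * (v j * w i)) (sym (au+bv≡0 j)) ⟩
    (a * u j + b * v j) * w i - b * (v j * w i) ≡⟨ sym (expand (u j) (v j) (w i)) ⟩
    a * (u j * w i)                             ∎)
  where
  open ≡-Reasoning
  expand : ∀ x y z → a * (x * z) ≡ (a * x + b * y) * z - b * (y * z)
  expand x y z = solve (a ∷ b ∷ x ∷ y ∷ z ∷ [])
  zero-factor : ∀ x y z → 0ℤ * x - z ≡ 0ℤ * y - z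
  zero-factor = solve-∀

M₂-≡ : ∀ {A B : M₂} → e11 A ≡ e11 B → e12 A ≡ e12 B → e21 A ≡ e21 B → e22 A ≡ e22 B → A ≡ B
M₂-≡ {mat _ _ _ _} {mat _ _ _ _} refl refl refl refl = refl

*M-assoc : ∀ A B C → A *M (B *M C) ≡ (A *M B) *M C
*M-assoc (mat a₁ a₂ a₃ a₄) (mat b₁ b₂ b₃ b₄) (mat c₁ c₂ c₃ c₄) =
  M₂-≡ (entry a₁ a₂ c₁ c₃) (entry a₁ a₂ c₂ c₄) (entry a₃ a₄ c₁ c₃) (entry a₃ a₄ c₂ c₄)
  where
  entry : ∀ x y z w → x * (b₁ * z + b₂ * w) + y * (b₃ * z + b₄ * w)
                    ≡ (x * b₁ + y * b₃) * z + (x * b₂ + y * b₄) * w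
  entry x y z w = solve (x ∷ y ∷ z ∷ w ∷ b₁ ∷ b₂ ∷ b₃ ∷ b₄ ∷ [])

I-central : ∀ A → A *M I ≡ I *M A
I-central (mat p q r s) = M₂-≡ entry₁₁ entry₁₂ entry₂₁ entry₂₂
  where
  entry₁₁ : p * 1ℤ + q * 0ℤ ≡ 1ℤ * p + 0ℤ * r
  entry₁₁ = solve (p ∷ q ∷ r ∷ [])
  entry₁₂ : p * 0ℤ + q * 1ℤ ≡ 1ℤ * q + 0ℤ * s
  entry₁₂ = solve (p ∷ q ∷ s ∷ [])
  entry₂₁ : r * 1ℤ + s * 0ℤ ≡ 0ℤ * p + 1ℤ * r
  entry₂₁ = solve (p ∷ r ∷ s ∷ [])
  entry₂₂ : r * 0ℤ + s * 1ℤ ≡ 0ℤ * q + 1ℤ * s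
  entry₂₂ = solve (q ∷ r ∷ s ∷ [])

^M-commutes : ∀ A n → A *M (A ^M n) ≡ (A ^M n) *M A
^M-commutes A zero    = I-central A
^M-commutes A (suc n) = trans (cong (A *M_) (^M-commutes A n)) (*M-assoc A (A ^M n) A)

deviation : M₂ → Vector ℤ 3
deviation A 0F = e11 A - e22 A
deviation A 1F = e12 A
deviation A 2F = e21 A

deviation-linear : ∀ a b A B i →
                   deviation ((a ·M A) +M (b ·M B)) i ≡ a * deviation A i + b * deviation B i
deviation-linear a b (mat p _ _ s) (mat p′ _ _ s′) 0F = distrib-difference
  where
  distrib-difference : (a * p + b * p′) - (a * s + b * s′) ≡ a * (p - s) + b * (p′ - s′)
  distrib-difference = solve (a ∷ b ∷ p ∷ s ∷ p′ ∷ s′ ∷ [])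
deviation-linear a b A B 1F = refl
deviation-linear a b A B 2F = refl

deviation-scalar : ∀ c i → deviation (c ·M I) i ≡ 0ℤ
deviation-scalar c 0F = i≡j⇒i-j≡0 {c * 1ℤ} refl
deviation-scalar c 1F = *-zeroʳ c
deviation-scalar c 2F = *-zeroʳ c

deviation≡0⇒scalar : ∀ A → (∀ i → deviation A i ≡ 0ℤ) → IsScalar A
deviation≡0⇒scalar A δ≡0 = e11 A , M₂-≡
  (sym (*-identityʳ (e11 A)))
  (trans (δ≡0 1F) (sym (*-zeroʳ (e11 A))))
  (trans (δ≡0 2F) (sym (*-zeroʳ (e11 A))))
  (trans (sym (i-j≡0⇒i≡j _ _ (δ≡0 0F))) (sym (*-identityʳ (e11 A))))

commutator₁₁ : ∀ x y z w x′ y′ z′ w′ →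
               (x * x′ + y * z′) - (x′ * x + y′ * z) ≡ y * z′ - z * y′
commutator₁₁ = solve-∀

commutator₁₂ : ∀ x y z w x′ y′ z′ w′ →
               (x * y′ + y * w′) - (x′ * y + y′ * w) ≡ (x - w) * y′ - y * (x′ - w′)
commutator₁₂ = solve-∀

commutator₂₁ : ∀ x y z w x′ y′ z′ w′ →
               (z * x′ + w * z′) - (z′ * x + w′ * z) ≡ z * (x′ - w′) - (x - w) * z′
commutator₂₁ = solve-∀

commutator₂₂ : ∀ x y z w x′ y′ z′ w′ →
               (z * y′ + w * w′) - (z′ * y + w′ * w) ≡ z * y′ - y * z′
commutator₂₂ = solve-∀

commute⇒∥ : ∀ X Y → X *M Y ≡ Y *M X → deviation X ∥ deviation Y
commute⇒∥ (mat x y z w) (mat x′ y′ z′ w′) XY≡YX = ∥₃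
  (≡-from-differences (commutator₁₂ x y z w x′ y′ z′ w′) (cong e12 XY≡YX))
  (sym (≡-from-differences (commutator₂₁ x y z w x′ y′ z′ w′) (cong e21 XY≡YX)))
  (≡-from-differences (commutator₁₁ x y z w x′ y′ z′ w′) (cong e11 XY≡YX))

∥⇒commute : ∀ X Y → deviation X ∥ deviation Y → X *M Y ≡ Y *M X
∥⇒commute (mat x y z w) (mat x′ y′ z′ w′) δX∥δY = M₂-≡
  (≡-from-differences (sym (commutator₁₁ x y z w x′ y′ z′ w′)) (minor δX∥δY 1F 2F))
  (≡-from-differences (sym (commutator₁₂ x y z w x′ y′ z′ w′)) (minor δX∥δY 0F 1F))
  (≡-from-differences (sym (commutator₂₁ x y z w x′ y′ z′ w′)) (minor δX∥δY 2F 0F))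
  (≡-from-differences (sym (commutator₂₂ x y z w x′ y′ z′ w′)) (minor δX∥δY 2F 1F))

deviation-combination : ∀ a b c A B → (a ·M A) +M (b ·M B) ≡ c ·M I →
                        ∀ i → a * deviation A i + b * deviation B i ≡ 0ℤ
deviation-combination a b c A B eq i = begin
  a * deviation A i + b * deviation B i  ≡⟨ sym (deviation-linear a b A B i) ⟩
  deviation ((a ·M A) +M (b ·M B)) i     ≡⟨ cong (λ M → deviation M i) eq ⟩
  deviation (c ·M I) i                   ≡⟨ deviation-scalar c i ⟩
  0ℤ                                     ∎
  where open ≡-Reasoning

theorem2p1 : (a b c : ℤ) → a ≢ 0ℤ → b ≢ 0ℤ → c ≢ 0ℤ → gcd (gcd a b) c ≡ 1ℤ →
    (m n : ℕ) → NonZero m → NonZero n → (X Y : M₂) →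
    (a ·M (X ^M m)) +M (b ·M (Y ^M n)) ≡ c ·M I → X *M Y ≢ Y *M X →
    IsScalar (X ^M m) × IsScalar (Y ^M n)
theorem2p1 a b c a≢0 b≢0 _ _ m n _ _ X Y eq XY≢YX =
  deviation≡0⇒scalar (X ^M m) δXᵐ≡0 , deviation≡0⇒scalar (Y ^M n) δYⁿ≡0
  where
  combination : ∀ i → a * deviation (X ^M m) i + b * deviation (Y ^M n) i ≡ 0ℤ
  combination = deviation-combination a b c (X ^M m) (Y ^M n) eq
  δXᵐ≟0 : ∀ i → Dec (deviation (X ^M m) i ≡ 0ℤ)
  δXᵐ≟0 i = deviation (X ^M m) i ≟ 0ℤ
  δXᵐ≡0 : ∀ i → deviation (X ^M m) i ≡ 0ℤ
  δXᵐ≡0 = decidable-stable (all? δXᵐ≟0) λ Xᵐ-nonscalar →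
    let (k , δₖXᵐ≢0) = ¬∀⟶∃¬ 3 _ δXᵐ≟0 Xᵐ-nonscalar in
    XY≢YX (∥⇒commute X Y (∥-euclidean k δₖXᵐ≢0
      (commute⇒∥ (X ^M m) X (sym (^M-commutes X m)))
      (proportional-∥ a b a≢0 combination (commute⇒∥ (Y ^M n) Y (sym (^M-commutes Y n))))))
  δYⁿ≡0 : ∀ i → deviation (Y ^M n) i ≡ 0ℤ
  δYⁿ≡0 i = a*x+b*y≡0⇒y≡0 a b≢0 (δXᵐ≡0 i) (combination i)
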